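{- Let $T$ be a binary tree and $L_1,\ldots,L_\alpha\subseteq\mathcal{L}(T)$. Then the collection $T|L_1,\ldots,T|L_\alpha$ is edge sharing if and only if there is no partition $S_1\cup S_2$ of $\{1,\ldots,\alpha\}$ for which $T|\bigcup_{\beta\in S_1}L_\beta$ and $T|\bigcup_{\beta\in S_2}L_\beta$ are edge disjoint.
   Context: A binary tree has all internal vertices of degree $3$ and labeled leaves $\mathcal{L}(T)$. $\mathrm{path}_T(x,y)$ is the set of edges on the path from $x$ to $y$ in $T$. For $L\subseteq\mathcal{L}(T)$, $T|L$ is the restriction of $T$ to $L$ (minimal subtree spanning $L$ with degree-2 vertices suppressed). $T|A$ and $T|B$ are edge disjoint if $\mathrm{path}_T(u_1,v_1)\cap\mathrm{path}_T(u_2,v_2)=\emptyset$ for all $u_1,v_1\in A$, $u_2,v_2\in B$, and edge sharing otherwise. A collection $T|L_1,\ldots,T|L_\alpha$ is edge sharing if there is no partition $S_1\cup S_2$ of $\{1,\ldots,\alpha\}$ into two nonempty sets such that $T|L_\beta$ and $T|L_\gamma$ are edge disjoint for all $\beta\in S_1$, $\gamma\in S_2$. Partitions are into two nonempty parts. -}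

module Defs where

open import Data.Nat using (ℕ; _≤_; _≥_)
open import Data.Fin using (Fin)
open import Data.Fin.Subset using (Subset; _∈_; _∉_; ∣_∣; Nonempty; ∁)
open import Data.Bool using (Bool; true; false; T)
open import Data.List using (List; []; _∷_; length)
open import Data.List.Relation.Unary.Unique.Propositional using (Unique)
open import Data.Vec using (tabulate)
open import Data.Product using (Σ; ∃; ∃-syntax; _×_; _,_)
open import Data.Sum using (_⊎_)
open import Data.Empty using (⊥)
open import Relation.Nullary using (¬_)
open import Relation.Binary.PropositionalEquality using (_≡_)

Adj : ℕ → Set
Adj n = Fin n → Fin n → Bool

data Walk {n : ℕ} (E : Adj n) : Fin n → Fin n → List (Fin n) → Set where
  here : ∀ {x} → Walk E x x (x ∷ [])
  step : ∀ {x y z vs} → T (E x y) → Walk E y z vs → Walk E x z (x ∷ vs)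

IsPath : ∀ {n} → Adj n → Fin n → Fin n → List (Fin n) → Set
IsPath E x y vs = Walk E x y vs × Unique vs

data Consec {A : Set} (a b : A) : List A → Set where
  now   : ∀ {xs} → Consec a b (a ∷ b ∷ xs)
  later : ∀ {x xs} → Consec a b xs → Consec a b (x ∷ xs)

HasCycle : ∀ {n} → Adj n → Set
HasCycle E = ∃[ x ] ∃[ y ] ∃[ vs ] (IsPath E x y vs × length vs ≥ 3 × T (E y x))

degree : ∀ {n} → Adj n → Fin n → ℕ
degree E v = ∣ tabulate (E v) ∣

record BinaryTree (n : ℕ) : Set where
  field
    E         : Adj n
    symmetric : ∀ x y → E x y ≡ E y x
    irreflex  : ∀ x → E x x ≡ false
    connected : ∀ x y → ∃[ vs ] Walk E x y vs
    acyclic   : ¬ HasCycle E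
    binary    : ∀ v → degree E v ≤ 1 ⊎ degree E v ≡ 3

open BinaryTree public

IsLeaf : ∀ {n} → BinaryTree n → Fin n → Set
IsLeaf T' v = degree (E T') v ≤ 1

OnPath : ∀ {n} → BinaryTree n → Fin n → Fin n → Fin n → Fin n → Set
OnPath T' u v a b =
  ∃[ vs ] (IsPath (E T') u v vs × (Consec a b vs ⊎ Consec b a vs))

LeafPred : ℕ → Set₁
LeafPred n = Fin n → Set

EdgeDisjoint : ∀ {n} → BinaryTree n → LeafPred n → LeafPred n → Set
EdgeDisjoint T' A B =
  ∀ u₁ v₁ u₂ v₂ → A u₁ → A v₁ → B u₂ → B v₂ →
  ∀ a b → T (E T' a b) → OnPath T' u₁ v₁ a b → OnPath T' u₂ v₂ a b → ⊥

_as-pred : ∀ {n} → Subset n → LeafPred n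
(L as-pred) x = x ∈ L

IsBipartition : ∀ {α} → Subset α → Set
IsBipartition S = Nonempty S × Nonempty (∁ S)

EdgeSharingCollection : ∀ {n α} → BinaryTree n → (Fin α → Subset n) → Set
EdgeSharingCollection T' L =
  ¬ (∃[ S ] (IsBipartition S ×
      (∀ β γ → β ∈ S → γ ∉ S → EdgeDisjoint T' ((L β) as-pred) ((L γ) as-pred))))

BigUnion : ∀ {n α} → (Fin α → Subset n) → Subset α → LeafPred n
BigUnion L S x = ∃[ β ] (β ∈ S × x ∈ L β)

{-# OPTIONS --safe #-}
-- Every edge ab of a tree splits the vertices into two sides, and ab lies on the path
-- from x to y exactly when x and y are on different sides; moreover a side of one edge
-- that meets a side of another edge, but avoids its endpoint, is contained in it.
--
-- Suppose S is a bipartition of the indices with no edge sharing across it, and ⋃ S lies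
-- in a region W: the whole vertex set, or one side of an edge.  If ⋃ S and ⋃ ∁S share an
-- edge f, then f separates two points of each union.  If f separates the leaves of some
-- member of S, it separates no member of ∁S, and the members of ∁S on a suitable side of
-- f, a side strictly inside W, form a new such bipartition.  Otherwise the members of S
-- on one side of f form a strictly smaller one within W.  Since strict inclusion is well
-- founded, this lexicographic descent in (W, S) must stop at a bipartition whose unions
-- are edge-disjoint.
--
-- Neither the degree condition on the tree nor the leaf hypothesis is ever used.
module Submission where

open import Defs
open import Data.Nat using (ℕ)
open import Data.Fin using (Fin)
open import Data.Fin.Subset using (Subset; _∈_; ∁)
open import Data.Product using (∃-syntax; _×_)
open import Relation.Nullary using (¬_)
open import Function.Bundles using (_⇔_)

open import Data.Bool using (Bool; true; false; T; not)
import Data.Bool.Properties as Bool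
open import Data.Bool.Properties using (¬-not; not-¬)
open import Data.Empty using (⊥; ⊥-elim)
open import Data.Fin.Properties using (_≟_; any?; all?)
open import Data.Fin.Subset using (_∉_; _⊆_; _⊂_; _∩_; ⊤; Nonempty)
open import Data.Fin.Subset.Induction using (Acc; acc; ⊂-wellFounded)
open import Data.Fin.Subset.Properties
  using (_∈?_; ∈⊤; ⊆⊤; x∈p∩q⁺; x∈p∩q⁻; x∈∁p⇒x∉p; x∉p⇒x∈∁p; x∉∁p⇒x∈p)
open import Data.List using (List; []; _∷_; _++_; length)
open import Data.List.Membership.Propositional using () renaming (_∈_ to _∈ₗ_; _∉_ to _∉ₗ_)
open import Data.List.Membership.Propositional.Properties using (∈-++⁻)
open import Data.List.Properties using (∷-injectiveʳ)
open import Data.List.Relation.Binary.Subset.Propositional using () renaming (_⊆_ to _⊆ₗ_)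
open import Data.List.Relation.Binary.Subset.Propositional.Properties using (∷⁺ʳ)
open import Data.List.Relation.Unary.All using ([]; _∷_)
open import Data.List.Relation.Unary.All.Properties using (All¬⇒¬Any; ¬Any⇒All¬)
open import Data.List.Relation.Unary.AllPairs using ([]; _∷_)
open import Data.List.Relation.Unary.Any using (here; there)
open import Data.Nat using (_≤_; s≤s; z≤n)
open import Data.Product using (_,_; proj₁; proj₂; swap)
import Data.Product as Product
open import Data.Sum using (_⊎_; inj₁; inj₂; [_,_]′)
import Data.Sum as Sum
open import Data.Vec using (tabulate)
open import Data.Vec.Properties using (lookup∘tabulate; []=⇒lookup; lookup⇒[]=)
open import Function using (_∘_; id; flip)
open import Function.Bundles using (mk⇔)
open import Level using (0ℓ)
open import Relation.Binary.PropositionalEquality using (_≡_; _≢_; refl; sym; trans; subst; cong)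
open import Relation.Nullary using (Dec; yes; no; does)
open import Relation.Nullary.Decidable
  using (dec-true; dec-false; decidable-stable; _×-dec_; _→-dec_; ¬?)
open import Relation.Unary using (Pred; Decidable)

≢⇒one-equals : ∀ {p q : Bool} → p ≢ q → ∀ t → (p ≡ t × q ≢ t) ⊎ (q ≡ t × p ≢ t)
≢⇒one-equals {p} {q} p≢q t with p Bool.≟ t
... | yes p≡t = inj₁ (p≡t , λ q≡t → p≢q (trans p≡t (sym q≡t)))
... | no p≢t = inj₂ (trans (¬-not (p≢q ∘ sym)) (sym (¬-not (p≢t ∘ sym))) , p≢t)

both-≢⇒≡ : ∀ {p q t : Bool} → p ≢ t → q ≢ t → p ≡ q
both-≢⇒≡ p≢t q≢t = trans (¬-not p≢t) (sym (¬-not q≢t))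

module _ {m : ℕ} {P : Pred (Fin m) 0ℓ} (P? : Decidable P) where

  subsetOf : Subset m
  subsetOf = tabulate (does ∘ P?)

  ∈-subsetOf⁺ : ∀ {i} → P i → i ∈ subsetOf
  ∈-subsetOf⁺ {i} p = lookup⇒[]= i _ (trans (lookup∘tabulate (does ∘ P?) i) (dec-true (P? i) p))

  ∈-subsetOf⁻ : ∀ {i} → i ∈ subsetOf → P i
  ∈-subsetOf⁻ {i} i∈ with P? i | trans (sym (lookup∘tabulate (does ∘ P?) i)) ([]=⇒lookup i∈)
  ... | yes p | _ = p
  ... | no _ | ()

module Tree {n : ℕ} (Tr : BinaryTree n) where

  open import Data.List.Membership.DecPropositional (_≟_ {n}) using () renaming (_∈?_ to _∈ₗ?_)

  private
    G : Adj n
    G = E Tr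

    variable
      a b c d u x y z : Fin n
      t : Bool
      vs ws : List (Fin n)
      A A′ B B′ : LeafPred n
      W : Subset n

  adjacent-sym : T (G x y) → T (G y x)
  adjacent-sym {x} {y} = subst T (symmetric Tr x y)

  adjacent⇒≢ : T (G x y) → x ≢ y
  adjacent⇒≢ {x} xy refl = subst T (irreflex Tr x) xy

  walk-start∈ : Walk G x y vs → x ∈ₗ vs
  walk-start∈ here = here refl
  walk-start∈ (step _ _) = here refl

  walk-end∈ : Walk G x y vs → y ∈ₗ vs
  walk-end∈ here = here refl
  walk-end∈ (step _ w) = there (walk-end∈ w)

  walk-head : Walk G x y (z ∷ vs) → x ≡ z
  walk-head here = refl
  walk-head (step _ _) = refl

  walk-length≥2 : Walk G x y vs → x ≢ y → 2 ≤ length vs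
  walk-length≥2 here x≢y = ⊥-elim (x≢y refl)
  walk-length≥2 (step _ here) _ = s≤s (s≤s z≤n)
  walk-length≥2 (step _ (step _ _)) _ = s≤s (s≤s z≤n)

  walk-++ : Walk G x y vs → Walk G y z ws → ∃[ us ] (Walk G x z us × us ⊆ₗ vs ++ ws)
  walk-++ here w = _ , w , there
  walk-++ (step xy w₁) w₂ with walk-++ w₁ w₂
  ... | _ , w , ⊆w₁w₂ = _ , step xy w , ∷⁺ʳ _ ⊆w₁w₂

  walk-reverse : Walk G x y vs → ∃[ us ] (Walk G y x us × us ⊆ₗ vs)
  walk-reverse here = _ , here , id
  walk-reverse (step xy w) with walk-reverse w
  ... | us , w⁻¹ , ⊆w with walk-++ w⁻¹ (step (adjacent-sym xy) here)
  ...   | _ , w′ , ⊆w′ = _ , w′ , [ there ∘ ⊆w , last-step ]′ ∘ ∈-++⁻ us ∘ ⊆w′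
    where
    last-step : ∀ {v} → v ∈ₗ _ ∷ _ ∷ [] → v ∈ₗ _ ∷ _
    last-step (here refl) = there (walk-start∈ w)
    last-step (there (here refl)) = here refl

  path-suffix : IsPath G x y vs → z ∈ₗ vs → ∃[ us ] (IsPath G z y us × us ⊆ₗ vs)
  path-suffix p@(here , _) (here refl) = _ , p , id
  path-suffix p@(step _ _ , _) (here refl) = _ , p , id
  path-suffix (step _ w , _ ∷ u) (there z∈) with path-suffix (w , u) z∈
  ... | _ , p , ⊆w = _ , p , there ∘ ⊆w

  walk⇒path : Walk G x y vs → ∃[ us ] (IsPath G x y us × us ⊆ₗ vs)
  walk⇒path here = _ , (here , [] ∷ []) , id
  walk⇒path {x} (step xz w) with walk⇒path w
  ... | us , p , ⊆w with x ∈ₗ? us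
  ...   | yes x∈ = let (_ , p′ , ⊆p) = path-suffix p x∈ in _ , p′ , there ∘ ⊆w ∘ ⊆p
  ...   | no x∉ = _ , (step xz (proj₁ p) , ¬Any⇒All¬ us x∉ ∷ proj₂ p) , ∷⁺ʳ x ⊆w

  cycle : T (G x y) → T (G x z) → y ≢ z → Walk G y z vs → x ∉ₗ vs → HasCycle G
  cycle {x} {z = z} xy xz y≢z w x∉ with walk⇒path w
  ... | p , (w′ , u) , ⊆w =
    x , z , x ∷ p , (step xy w′ , ¬Any⇒All¬ p (x∉ ∘ ⊆w) ∷ u) ,
    s≤s (walk-length≥2 w′ y≢z) , adjacent-sym xz

  path-unique : IsPath G x y vs → IsPath G x y ws → vs ≡ ws
  path-unique (here , _) (here , _) = refl
  path-unique (here , _) (step _ w , x∉ ∷ _) = ⊥-elim (All¬⇒¬Any x∉ (walk-end∈ w))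
  path-unique (step _ w , x∉ ∷ _) (here , _) = ⊥-elim (All¬⇒¬Any x∉ (walk-end∈ w))
  path-unique {x} (step {y = v} xv w₁ , x∉₁ ∷ u₁) (step {y = v′} xv′ w₂ , x∉₂ ∷ u₂)
    with v ≟ v′
  ... | yes refl = cong (x ∷_) (path-unique (w₁ , u₁) (w₂ , u₂))
  ... | no v≢v′ with walk-reverse w₂
  ...   | _ , w₂⁻¹ , ⊆w₂ with walk-++ w₁ w₂⁻¹
  ...     | _ , detour , ⊆detour =
    ⊥-elim (acyclic Tr (cycle xv xv′ v≢v′ detour
      ([ All¬⇒¬Any x∉₁ , All¬⇒¬Any x∉₂ ∘ ⊆w₂ ]′ ∘ ∈-++⁻ _ ∘ ⊆detour)))

  path : Fin n → Fin n → List (Fin n)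
  path x y = proj₁ (walk⇒path (proj₂ (connected Tr x y)))

  path-isPath : ∀ x y → IsPath G x y (path x y)
  path-isPath x y = proj₁ (proj₂ (walk⇒path (proj₂ (connected Tr x y))))

  -- side a b x = true  iff  x lies on b's side of the edge ab.
  side : Fin n → Fin n → Fin n → Bool
  side a b x = does (b ∈ₗ? path x a)

  side-true : b ∈ₗ path x a → side a b x ≡ true
  side-true = dec-true (_ ∈ₗ? _)

  side-false : b ∉ₗ path x a → side a b x ≡ false
  side-false = dec-false (_ ∈ₗ? _)

  side-b : side a b b ≡ true
  side-b {a} {b} = side-true (walk-start∈ (proj₁ (path-isPath b a)))

  SameEdge : Fin n → Fin n → Fin n → Fin n → Set
  SameEdge a b x z = (x ≡ a × z ≡ b) ⊎ (x ≡ b × z ≡ a)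

  Traverses : Fin n → Fin n → List (Fin n) → Set
  Traverses a b vs = Consec a b vs ⊎ Consec b a vs

  consec-∈ : Consec a b vs → a ∈ₗ vs × b ∈ₗ vs
  consec-∈ now = here refl , there (here refl)
  consec-∈ (later c) = Product.map there there (consec-∈ c)

  traverses-∈ : Traverses a b vs → a ∈ₗ vs × b ∈ₗ vs
  traverses-∈ (inj₁ c) = consec-∈ c
  traverses-∈ (inj₂ c) = swap (consec-∈ c)

  sameEdge-∈ : SameEdge a b x z → Traverses a b vs → x ∈ₗ vs
  sameEdge-∈ (inj₁ (refl , _)) = proj₁ ∘ traverses-∈
  sameEdge-∈ (inj₂ (refl , _)) = proj₂ ∘ traverses-∈

  walk-consec : Walk G z y vs → Consec x z (x ∷ vs)
  walk-consec here = now
  walk-consec (step _ _) = now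

  traverses-∷⁺ : Walk G z y vs → SameEdge a b x z ⊎ Traverses a b vs → Traverses a b (x ∷ vs)
  traverses-∷⁺ w (inj₁ (inj₁ (refl , refl))) = inj₁ (walk-consec w)
  traverses-∷⁺ w (inj₁ (inj₂ (refl , refl))) = inj₂ (walk-consec w)
  traverses-∷⁺ w (inj₂ tr) = Sum.map later later tr

  traverses-∷⁻ : Walk G z y vs → Traverses a b (x ∷ vs) → SameEdge a b x z ⊎ Traverses a b vs
  traverses-∷⁻ w (inj₁ now) = inj₁ (inj₁ (refl , walk-head w))
  traverses-∷⁻ w (inj₂ now) = inj₁ (inj₂ (refl , walk-head w))
  traverses-∷⁻ w (inj₁ (later c)) = inj₂ (inj₁ c)
  traverses-∷⁻ w (inj₂ (later c)) = inj₂ (inj₂ c)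

  module _ (ab : T (G a b)) where

    side-a : side a b a ≡ false
    side-a = side-false (b∉[a] ∘ subst (b ∈ₗ_) (path-unique (path-isPath a a) (here , [] ∷ [])))
      where
      b∉[a] : b ∉ₗ a ∷ []
      b∉[a] (here b≡a) = adjacent⇒≢ ab (sym b≡a)

    ends-differ : side a b a ≢ side a b b
    ends-differ eq with trans (sym side-a) (trans eq side-b)
    ... | ()

    sameEdge⇒sides≢ : SameEdge a b x z → side a b x ≢ side a b z
    sameEdge⇒sides≢ (inj₁ (refl , refl)) = ends-differ
    sameEdge⇒sides≢ (inj₂ (refl , refl)) = ends-differ ∘ sym

    leaving : T (G x z) → b ∈ₗ path x a → b ∉ₗ path z a → x ≡ b × z ≡ a
    leaving {x} {z} xz b∈ b∉ with x ∈ₗ? path z a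
    ... | yes x∈ with path-suffix (path-isPath z a) x∈
    ...   | _ , p , ⊆p = ⊥-elim (b∉ (⊆p (subst (b ∈ₗ_) (path-unique (path-isPath x a) p) b∈)))
    leaving {x} {z} xz b∈ b∉ | no x∉ = x≡b , z≡a
      where
      via-z : IsPath G x a (x ∷ path z a)
      via-z = step xz (proj₁ (path-isPath z a)) , ¬Any⇒All¬ _ x∉ ∷ proj₂ (path-isPath z a)

      x≡b : x ≡ b
      x≡b with subst (b ∈ₗ_) (path-unique (path-isPath x a) via-z) b∈
      ... | here b≡x = sym b≡x
      ... | there b∈′ = ⊥-elim (b∉ b∈′)

      b→a : IsPath G b a (b ∷ a ∷ [])
      b→a = step (adjacent-sym ab) here , ((adjacent⇒≢ ab ∘ sym) ∷ []) ∷ [] ∷ []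

      z≡a : z ≡ a
      z≡a with x≡b
      ... | refl = walk-head (subst (Walk G z a) (∷-injectiveʳ (path-unique via-z b→a))
                                    (proj₁ (path-isPath z a)))

    sides≢⇒sameEdge : T (G x z) → side a b x ≢ side a b z → SameEdge a b x z
    sides≢⇒sameEdge {x} {z} xz x≢z with b ∈ₗ? path x a | b ∈ₗ? path z a
    ... | yes b∈x | no b∉z = inj₂ (leaving xz b∈x b∉z)
    ... | no b∉x | yes b∈z = inj₁ (swap (leaving (adjacent-sym xz) b∈z b∉x))
    ... | yes _ | yes _ = ⊥-elim (x≢z refl)
    ... | no _ | no _ = ⊥-elim (x≢z refl)

    side-step : T (G x z) → ¬ SameEdge a b x z → side a b x ≡ side a b z
    side-step {x} {z} xz ¬same =
      decidable-stable (side a b x Bool.≟ side a b z) (¬same ∘ sides≢⇒sameEdge xz)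

    side-constant : Walk G x y vs → ¬ Traverses a b vs → u ∈ₗ vs → side a b u ≡ side a b x
    side-constant here _ (here refl) = refl
    side-constant (step _ _) _ (here refl) = refl
    side-constant (step xz w) ¬tr (there u∈) =
      trans (side-constant w (¬tr ∘ traverses-∷⁺ w ∘ inj₂) u∈)
            (sym (side-step xz (¬tr ∘ traverses-∷⁺ w ∘ inj₁)))

    sides≢⇒traverses : Walk G x y vs → side a b x ≢ side a b y → Traverses a b vs
    sides≢⇒traverses here x≢y = ⊥-elim (x≢y refl)
    sides≢⇒traverses {x} (step {y = z} xz w) x≢y with side a b x Bool.≟ side a b z
    ... | yes x≡z = traverses-∷⁺ w (inj₂ (sides≢⇒traverses w (x≢y ∘ trans x≡z)))
    ... | no x≢z = traverses-∷⁺ w (inj₁ (sides≢⇒sameEdge xz x≢z))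

    traverses⇒sides≢ : IsPath G x y vs → Traverses a b vs → side a b x ≢ side a b y
    traverses⇒sides≢ (here , _) (inj₁ (later ()))
    traverses⇒sides≢ (here , _) (inj₂ (later ()))
    traverses⇒sides≢ (step xz w , x∉ ∷ u) tr with traverses-∷⁻ w tr
    ... | inj₁ same = λ x≡y → sameEdge⇒sides≢ same
            (trans x≡y (side-constant w (All¬⇒¬Any x∉ ∘ sameEdge-∈ same) (walk-end∈ w)))
    ... | inj₂ tr′ = λ x≡y → traverses⇒sides≢ (w , u) tr′
            (trans (sym (side-step xz (All¬⇒¬Any x∉ ∘ flip sameEdge-∈ tr′))) x≡y)

  onPath⇒sides≢ : T (G a b) → OnPath Tr x y a b → side a b x ≢ side a b y
  onPath⇒sides≢ ab (_ , p , tr) = traverses⇒sides≢ ab p tr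

  sides≢⇒onPath : T (G a b) → side a b x ≢ side a b y → OnPath Tr x y a b
  sides≢⇒onPath {x = x} {y} ab x≢y =
    path x y , path-isPath x y , sides≢⇒traverses ab (proj₁ (path-isPath x y)) x≢y

  -- cd lies on the path from x to y, all of whose vertices ab leaves on one side.
  side-compat : T (G a b) → T (G c d) → side c d x ≢ side c d y → side a b x ≡ side a b y →
                side a b c ≡ side a b x
  side-compat {x = x} {y} ab cd cd-sep ab-same =
    side-constant ab xy (λ tr → traverses⇒sides≢ ab (path-isPath x y) tr ab-same)
      (proj₁ (traverses-∈ (sides≢⇒traverses cd xy cd-sep)))
    where
    xy : Walk G x y (path x y)
    xy = proj₁ (path-isPath x y)

  sideSet : Fin n → Fin n → Bool → Subset n
  sideSet a b t = subsetOf (λ x → side a b x Bool.≟ t)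

  ∈-sideSet⁺ : side a b x ≡ t → x ∈ sideSet a b t
  ∈-sideSet⁺ {a = a} {b} {t = t} = ∈-subsetOf⁺ (λ x → side a b x Bool.≟ t)

  ∈-sideSet⁻ : x ∈ sideSet a b t → side a b x ≡ t
  ∈-sideSet⁻ {a = a} {b} {t = t} = ∈-subsetOf⁻ (λ x → side a b x Bool.≟ t)

  sideSet-nested : T (G a b) → T (G c d) → z ∈ sideSet c d t → side a b z ≡ not (side a b c) →
                   sideSet a b (not (side a b c)) ⊆ sideSet c d t
  sideSet-nested {a} {b} {c} {d} {t = t} ab cd z∈ z-far {w} w∈ =
    ∈-sideSet⁺ (decidable-stable (side c d w Bool.≟ t) λ w-out →
      not-¬ refl (trans (side-compat ab cd (w-out ∘ flip trans (∈-sideSet⁻ z∈))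
                                            (trans (∈-sideSet⁻ w∈) (sym z-far)))
                        (∈-sideSet⁻ w∈)))

  data Region : Subset n → Set where
    whole : Region ⊤
    half  : T (G a b) → ∀ t → Region (sideSet a b t)

  region-split : Region W → T (G a b) → x ∈ W → y ∈ W → side a b x ≢ side a b y →
                 ∃[ t ] (sideSet a b t ⊂ W)
  region-split {a = a} {b} {x} {y} whole ab _ _ x≢y =
    side a b x , ⊆⊤ , y , ∈⊤ , x≢y ∘ sym ∘ ∈-sideSet⁻
  region-split {a = a} {b} (half {c} cd t) ab x∈ y∈ x≢y with ≢⇒one-equals x≢y (not (side a b c))
  ... | inj₁ (x-far , y-near) = _ , sideSet-nested ab cd x∈ x-far , _ , y∈ , y-near ∘ ∈-sideSet⁻
  ... | inj₂ (y-far , x-near) = _ , sideSet-nested ab cd y∈ y-far , _ , x∈ , x-near ∘ ∈-sideSet⁻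

  Separates : Fin n → Fin n → LeafPred n → Set
  Separates a b A = ∃[ x ] ∃[ y ] (A x × A y × side a b x ≢ side a b y)

  separates? : ∀ a b (X : Subset n) → Dec (Separates a b (X as-pred))
  separates? a b X =
    any? λ x → any? λ y → x ∈? X ×-dec y ∈? X ×-dec ¬? (side a b x Bool.≟ side a b y)

  OnSide : Fin n → Fin n → Bool → LeafPred n → Set
  OnSide a b t A = ∀ x → A x → side a b x ≡ t

  onSide? : ∀ a b t (X : Subset n) → Dec (OnSide a b t (X as-pred))
  onSide? a b t X = all? λ x → x ∈? X →-dec side a b x Bool.≟ t

  ¬separates⇒onSide : ¬ Separates a b A → A x → OnSide a b (side a b x) A
  ¬separates⇒onSide {a} {b} {A} {x} ¬sep x∈ y y∈ =
    decidable-stable (side a b y Bool.≟ side a b x) λ y≢x → ¬sep (y , x , y∈ , x∈ , y≢x)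

  edgeDisjoint-sym : EdgeDisjoint Tr A B → EdgeDisjoint Tr B A
  edgeDisjoint-sym ed u v u′ v′ u∈ v∈ u′∈ v′∈ a b ab on on′ =
    ed u′ v′ u v u′∈ v′∈ u∈ v∈ a b ab on′ on

  edgeDisjoint-mono : (∀ {x} → A′ x → A x) → (∀ {x} → B′ x → B x) →
                      EdgeDisjoint Tr A B → EdgeDisjoint Tr A′ B′
  edgeDisjoint-mono A′⊆A B′⊆B ed u v u′ v′ u∈ v∈ u′∈ v′∈ =
    ed u v u′ v′ (A′⊆A u∈) (A′⊆A v∈) (B′⊆B u′∈) (B′⊆B v′∈)

  edgeDisjoint⇒¬separatesBoth : EdgeDisjoint Tr A B → T (G a b) →
                                Separates a b A → Separates a b B → ⊥
  edgeDisjoint⇒¬separatesBoth {a = a} {b} ed ab (u , v , u∈ , v∈ , u≢v)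
                                                (u′ , v′ , u′∈ , v′∈ , u′≢v′) =
    ed u v u′ v′ u∈ v∈ u′∈ v′∈ a b ab (sides≢⇒onPath ab u≢v) (sides≢⇒onPath ab u′≢v′)

  -- For a shared edge cd, c would lie on ab's side t (seen from A) and off it (seen from B).
  opposite-sides⇒edgeDisjoint : T (G a b) → OnSide a b t A → (∀ x → B x → side a b x ≢ t) →
                                EdgeDisjoint Tr A B
  opposite-sides⇒edgeDisjoint {a} {b} ab A-on B-off u v u′ v′ u∈ v∈ u′∈ v′∈ c d cd on on′ =
    B-off u′ u′∈ (trans (sym c~u′) (trans c~u (A-on u u∈)))
    where
    c~u : side a b c ≡ side a b u
    c~u = side-compat ab cd (onPath⇒sides≢ cd on) (trans (A-on u u∈) (sym (A-on v v∈)))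
    c~u′ : side a b c ≡ side a b u′
    c~u′ = side-compat ab cd (onPath⇒sides≢ cd on′) (both-≢⇒≡ (B-off u′ u′∈) (B-off v′ v′∈))

module Separation {n α : ℕ} (Tr : BinaryTree n) (L : Fin α → Subset n) where

  open Tree Tr

  private
    variable
      a b : Fin n
      t : Bool
      W : Subset n
      R S : Subset α
      β δ : Fin α

  Isolated : Subset α → Set
  Isolated S = ∀ β γ → β ∈ S → γ ∉ S → EdgeDisjoint Tr (L β as-pred) (L γ as-pred)

  isolated-∁ : Isolated S → Isolated (∁ S)
  isolated-∁ iso β γ β∈∁S γ∉∁S = edgeDisjoint-sym (iso γ β (x∉∁p⇒x∈p γ∉∁S) (x∈∁p⇒x∉p β∈∁S))

  unionsDisjoint⇒isolated : EdgeDisjoint Tr (BigUnion L S) (BigUnion L (∁ S)) → Isolated S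
  unionsDisjoint⇒isolated ed β γ β∈S γ∉S =
    edgeDisjoint-mono (λ x∈ → β , β∈S , x∈) (λ x∈ → γ , x∉p⇒x∈∁p γ∉S , x∈) ed

  Unseparated : Fin n → Fin n → Subset α → Set
  Unseparated a b R = ∀ δ → δ ∈ R → ¬ Separates a b (L δ as-pred)

  restrict : Subset α → Fin n → Fin n → Bool → Subset α
  restrict R a b t = R ∩ subsetOf (λ δ → onSide? a b t (L δ))

  ∈-restrict⁺ : ∀ {x} → δ ∈ R → ¬ Separates a b (L δ as-pred) → x ∈ L δ → side a b x ≡ t →
                δ ∈ restrict R a b t
  ∈-restrict⁺ {a = a} {b} {t} δ∈R ¬sep x∈ refl =
    x∈p∩q⁺ (δ∈R , ∈-subsetOf⁺ (λ δ → onSide? a b t (L δ)) (¬separates⇒onSide ¬sep x∈))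

  ∈-restrict⁻ : δ ∈ restrict R a b t → δ ∈ R × OnSide a b t (L δ as-pred)
  ∈-restrict⁻ {R = R} {a} {b} {t} δ∈ =
    Product.map₂ (∈-subsetOf⁻ (λ δ → onSide? a b t (L δ))) (x∈p∩q⁻ R _ δ∈)

  restrict-isolated : T (E Tr a b) → Isolated R → Unseparated a b R → Isolated (restrict R a b t)
  restrict-isolated {R = R} ab iso unsep δ δ′ δ∈ δ′∉ with δ′ ∈? R
  ... | no δ′∉R = iso δ δ′ (proj₁ (∈-restrict⁻ δ∈)) δ′∉R
  ... | yes δ′∈R = opposite-sides⇒edgeDisjoint ab (proj₂ (∈-restrict⁻ δ∈))
                     λ x x∈ x-on → δ′∉ (∈-restrict⁺ δ′∈R (unsep δ′ δ′∈R) x∈ x-on)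

  record Confined (W : Subset n) (S : Subset α) : Set where
    constructor confined
    field
      region      : Region W
      bipartition : IsBipartition S
      isolated    : Isolated S
      union⊆      : ∀ {x} → BigUnion L S x → x ∈ W

  shrink-across : Confined W S → T (E Tr a b) → β ∈ S → Separates a b (L β as-pred) →
                  Separates a b (BigUnion L (∁ S)) → ∃[ W′ ] ∃[ Q ] (W′ ⊂ W × Confined W′ Q)
  shrink-across {S = S} {a} {b} {β} (confined W-region _ iso S⊆W) ab β∈S
                β-sep@(x , y , x∈ , y∈ , x≢y) S̄-sep
    with region-split W-region ab (S⊆W (β , β∈S , x∈)) (S⊆W (β , β∈S , y∈)) x≢y
  ... | t , side⊂W = sideSet a b t , Q , side⊂W ,
                     confined (half ab t) (Q-nonempty S̄-sep , β , β∉Q) Q-isolated Q⊆side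
    where
    Q : Subset α
    Q = restrict (∁ S) a b t

    ∁S-unsep : Unseparated a b (∁ S)
    ∁S-unsep γ γ∈∁S = edgeDisjoint⇒¬separatesBoth (iso β γ β∈S (x∈∁p⇒x∉p γ∈∁S)) ab β-sep

    Q-nonempty : Separates a b (BigUnion L (∁ S)) → Nonempty Q
    Q-nonempty (u , v , (γ , γ∈ , u∈) , (γ′ , γ′∈ , v∈) , u≢v) with ≢⇒one-equals u≢v t
    ... | inj₁ (u-on , _) = γ , ∈-restrict⁺ γ∈ (∁S-unsep γ γ∈) u∈ u-on
    ... | inj₂ (v-on , _) = γ′ , ∈-restrict⁺ γ′∈ (∁S-unsep γ′ γ′∈) v∈ v-on

    β∉Q : β ∈ ∁ Q
    β∉Q = x∉p⇒x∈∁p λ β∈Q → x∈∁p⇒x∉p (proj₁ (∈-restrict⁻ β∈Q)) β∈S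

    Q-isolated : Isolated Q
    Q-isolated = restrict-isolated ab (isolated-∁ iso) ∁S-unsep

    Q⊆side : ∀ {x} → BigUnion L Q x → x ∈ sideSet a b t
    Q⊆side (δ , δ∈Q , x∈) = ∈-sideSet⁺ (proj₂ (∈-restrict⁻ δ∈Q) _ x∈)

  shrink-within : Confined W S → T (E Tr a b) → Unseparated a b S → Separates a b (BigUnion L S) →
                  ∃[ S′ ] (S′ ⊂ S × Confined W S′)
  shrink-within {W} {S} {a} {b} (confined W-region _ iso S⊆W) ab unsep
                (u , v , (β , β∈S , u∈) , (β′ , β′∈S , v∈) , u≢v) =
    S′ , (proj₁ ∘ ∈-restrict⁻ , β′ , β′∈S , β′∉S′) ,
    confined W-region ((β , β∈S′) , β′ , x∉p⇒x∈∁p β′∉S′) (restrict-isolated ab iso unsep) S′⊆W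
    where
    S′ : Subset α
    S′ = restrict S a b (side a b u)

    β∈S′ : β ∈ S′
    β∈S′ = ∈-restrict⁺ β∈S (unsep β β∈S) u∈ refl

    β′∉S′ : β′ ∉ S′
    β′∉S′ β′∈S′ = u≢v (sym (proj₂ (∈-restrict⁻ β′∈S′) v v∈))

    S′⊆W : ∀ {x} → BigUnion L S′ x → x ∈ W
    S′⊆W (δ , δ∈S′ , x∈) = S⊆W (δ , proj₁ (∈-restrict⁻ δ∈S′) , x∈)

  Shrinkable : Subset n → Subset α → Set
  Shrinkable W S = (∃[ W′ ] ∃[ Q ] (W′ ⊂ W × Confined W′ Q)) ⊎ (∃[ S′ ] (S′ ⊂ S × Confined W S′))

  unshrinkable⇒unionsDisjoint : Confined W S → ¬ Shrinkable W S →
                                EdgeDisjoint Tr (BigUnion L S) (BigUnion L (∁ S))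
  unshrinkable⇒unionsDisjoint {S = S} conf ¬shrinkable u v u′ v′ u∈ v∈ u′∈ v′∈ a b ab on on′
    with any? (λ β → β ∈? S ×-dec separates? a b (L β))
  ... | yes (β , β∈S , β-sep) =
    ¬shrinkable (inj₁ (shrink-across conf ab β∈S β-sep (u′ , v′ , u′∈ , v′∈ , onPath⇒sides≢ ab on′)))
  ... | no none =
    ¬shrinkable (inj₂ (shrink-within conf ab (λ β β∈S β-sep → none (β , β∈S , β-sep))
                                              (u , v , u∈ , v∈ , onPath⇒sides≢ ab on)))

  module _ (noSplit : ¬ (∃[ S ] (IsBipartition S ×
                                 EdgeDisjoint Tr (BigUnion L S) (BigUnion L (∁ S))))) where

    descend : Acc _⊂_ W → Acc _⊂_ S → Confined W S → ⊥
    descend {W} (acc smaller-W) = within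
      where
      within : Acc _⊂_ S → Confined W S → ⊥
      within {S} (acc smaller-S) conf =
        noSplit (S , Confined.bipartition conf , unshrinkable⇒unionsDisjoint conf unshrinkable)
        where
        unshrinkable : ¬ Shrinkable W S
        unshrinkable (inj₁ (_ , Q , W′⊂W , conf′)) = descend (smaller-W W′⊂W) (⊂-wellFounded Q) conf′
        unshrinkable (inj₂ (_ , S′⊂S , conf′)) = within (smaller-S S′⊂S) conf′

    edgeSharing : EdgeSharingCollection Tr L
    edgeSharing (S , bip , iso) =
      descend (⊂-wellFounded ⊤) (⊂-wellFounded S) (confined whole bip iso λ _ → ∈⊤)

proposition14 : ∀ {n α} (T : BinaryTree n) (L : Fin α → Subset n) →
    (∀ β x → x ∈ L β → IsLeaf T x) →
    EdgeSharingCollection T L ⇔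
      (¬ (∃[ S ] (IsBipartition S × EdgeDisjoint T (BigUnion L S) (BigUnion L (∁ S)))))
proposition14 T L _ = mk⇔
  (λ sharing (S , bip , unionsDisjoint) → sharing (S , bip , unionsDisjoint⇒isolated unionsDisjoint))
  edgeSharing
  where open Separation T L
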